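{- Let $n,m\ge2$. For an integer $N=p_1^{\alpha_1}\cdots p_s^{\alpha_s}$ let $N^*=p_1^{\lceil\alpha_1/2\rceil}\cdots p_s^{\lceil\alpha_s/2\rceil}$. Then the clique number of $\Gamma(\mathbb{Z}_n\times\mathbb{Z}_m)$ is at least $$cl(\Gamma(\mathbb{Z}_n))+cl(\Gamma(\mathbb{Z}_m))+\Big(\frac{n}{n^*}-1\Big)\Big(\frac{m}{m^*}-1\Big),$$ where $cl$ denotes the clique number.
   Context: For a commutative ring $R$ with identity, the zero-divisor graph $\Gamma(R)$ is the simple undirected graph whose vertices are the nonzero zero-divisors of $R$, two distinct vertices $u,v$ being adjacent iff $uv=0$. The clique number is the maximum size of a set of pairwise adjacent vertices (taken to be $0$ for a graph without vertices). -}

module Defs where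

open import Data.Nat using (ℕ; zero; suc; _+_; _*_; _^_; _≤_; ⌈_/2⌉)
open import Data.Nat.DivMod using (_/_)
open import Data.Nat.Divisibility using (_∣_; _∣?_)
open import Data.Nat.Primality using (prime?)
open import Data.Fin using (Fin; toℕ)
open import Data.Product using (_×_; ∃)
open import Data.List using (List; length)
open import Data.List.Relation.Unary.All using (All)
open import Data.List.Relation.Unary.Unique.Propositional using (Unique)
open import Data.List.Membership.Propositional using (_∈_)
open import Relation.Nullary using (¬_; yes; no)
open import Relation.Binary.PropositionalEquality using (_≡_; _≢_)

-- p-adic valuation of n for the prime candidate p = 2 + q
-- (fuel bounds the recursion; fuel = n suffices)
valFuel : ℕ → ℕ → ℕ → ℕ
valFuel q zero    n = 0
valFuel q (suc f) zero = 0
valFuel q (suc f) n@(suc _) with (2 + q) ∣? n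
... | yes _ = suc (valFuel q f (n / (2 + q)))
... | no  _ = 0

val : ℕ → ℕ → ℕ
val q n = valFuel q n n

-- product over all primes p with 2 ≤ p ≤ k + 1 of p ^ ⌈ v_p(n) / 2 ⌉
starUpTo : ℕ → ℕ → ℕ
starUpTo zero    n = 1
starUpTo (suc k) n with prime? (2 + k)
... | yes _ = (2 + k) ^ ⌈ val k n /2⌉ * starUpTo k n
... | no  _ = starUpTo k n

-- N* (all prime divisors of N ≥ 1 are ≤ N ≤ N + 1)
star : ℕ → ℕ
star n = starUpTo n n

record ZeroMul : Set₁ where
  field
    Carrier : Set
    IsZero  : Carrier → Set
    MulZero : Carrier → Carrier → Set

module _ (R : ZeroMul) where
  open ZeroMul R

  ZeroDivisor : Carrier → Set
  ZeroDivisor x = ¬ IsZero x × ∃ λ y → ¬ IsZero y × MulZero x y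

  IsClique : List Carrier → Set
  IsClique L = Unique L × All ZeroDivisor L ×
               (∀ {x y} → x ∈ L → y ∈ L → x ≢ y → MulZero x y)

  IsCliqueNumber : ℕ → Set
  IsCliqueNumber k = (∃ λ L → IsClique L × length L ≡ k) ×
                     (∀ L → IsClique L → length L ≤ k)

ℤ/ : ℕ → ZeroMul
ℤ/ n = record
  { Carrier = Fin n
  ; IsZero  = λ x → toℕ x ≡ 0
  ; MulZero = λ x y → n ∣ toℕ x * toℕ y
  }

ℤ/× : ℕ → ℕ → ZeroMul
ℤ/× n m = record
  { Carrier = Fin n × Fin m
  ; IsZero  = λ x → toℕ (proj₁ x) ≡ 0 × toℕ (proj₂ x) ≡ 0
  ; MulZero = λ x y → n ∣ toℕ (proj₁ x) * toℕ (proj₁ y) ×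
                      m ∣ toℕ (proj₂ x) * toℕ (proj₂ y)
  }
  where open import Data.Product using (proj₁; proj₂)

module Submission where

-- Write n = n* q. Since n ∣ (n*)² (every αᵢ ≤ 2⌈αᵢ/2⌉), q ∣ n*, so the nonzero multiples
-- n*, 2n*, …, (q − 1)n* of n* in ℤ_n annihilate each other and every multiple of q. A clique A of
-- Γ(ℤ_n) can be traded for one of the same size consisting of multiples of q: the k elements of A not
-- divisible by q have pairwise products divisible by q², hence pairwise distinct additive orders
-- modulo q, which forces k < q; replacing them by n*, …, k n* keeps a clique. For such cliques A of
-- ℤ_n and B of ℤ_m, the set (A × 0) ∪ (0 × B) ∪ (n*ℤ_n ∖ 0) × (m*ℤ_m ∖ 0) is a clique of
-- Γ(ℤ_n × ℤ_m) of the required size.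

open import Defs
open import Data.Fin using (Fin; toℕ; zero; suc)
open import Data.Fin.Properties using (toℕ-fromℕ<)
open import Data.List using (List; []; _∷_; length; map; upTo; filter; _++_; cartesianProduct)
open import Data.List.Properties using (length-map; length-upTo; length-++)
open import Data.List.Fresh as List# using (fromList)
import Data.List.Fresh.Membership.Setoid as Membership#
import Data.List.Fresh.Membership.Setoid.Properties as Membership#ₚ
import Data.List.Fresh.Relation.Unary.Any as Any#
open import Data.List.Membership.Propositional using (_∈_; _∉_)
open import Data.List.Membership.Propositional.Properties
  using (∈-map⁻; ∈-upTo⁺; ∈-upTo⁻; ∈-filter⁻; ∈-++⁻; ∈-cartesianProduct⁻)
open import Data.List.Relation.Unary.All as All using (All)
open import Data.List.Relation.Unary.All.Properties as All using ()
open import Data.List.Relation.Unary.AllPairs using ([]; _∷_)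
open import Data.List.Relation.Unary.Any using (here; there)
open import Data.List.Relation.Unary.Unique.Propositional using (Unique)
open import Data.List.Relation.Unary.Unique.Propositional.Properties as Unique using ()
open import Data.Nat
open import Data.Nat.Coprimality using (Coprime; coprime-/gcd; coprime-divisor)
open import Data.Nat.Divisibility
open import Data.Nat.DivMod using (_/_; _mod_; m/n*n≡m; m<n⇒m%n≡m)
open import Data.Nat.GCD using (gcd; gcd[m,n]∣m; gcd[m,n]∣n; gcd[m,n]≢0)
open import Data.Nat.Induction using (<-wellFounded)
open import Data.Nat.Primality
  using (_Rough_; prime?; 2-rough; ∤⇒rough-suc; rough∧∣⇒rough; rough∧∣⇒prime; rough⇒≤)
open import Data.Nat.Properties
open import Algebra.Properties.CommutativeSemigroup *-commutativeSemigroup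
  using (xy∙z≈xz∙y; x∙yz≈y∙xz; interchange)
open import Data.Product using (_×_; _,_; ∃; ∃₂; proj₁; proj₂)
open import Data.Sum using (_⊎_; inj₁; inj₂)
open import Function using (_∘_)
open import Induction.WellFounded using (Acc; acc)
open import Relation.Nullary using (¬_; Dec; yes; no; contradiction)
open import Relation.Nullary.Decidable using (¬?)
open import Relation.Binary.PropositionalEquality

module _ {A : Set} {P : A → Set} (P? : ∀ x → Dec (P x)) where

  length-filter+length-filter-¬ : ∀ xs → length (filter P? xs) + length (filter (¬? ∘ P?) xs) ≡ length xs
  length-filter+length-filter-¬ [] = refl
  length-filter+length-filter-¬ (x ∷ xs) with P? x
  ... | yes _ = cong suc (length-filter+length-filter-¬ xs)
  ... | no  _ = trans (+-suc _ _) (cong suc (length-filter+length-filter-¬ xs))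

module _ {A : Set} where
  open Membership# (setoid A) renaming (_∈_ to _∈#_)

  private
    length-fromList : ∀ {xs : List A} (u : Unique xs) → List#.length (fromList u) ≡ length xs
    length-fromList []      = refl
    length-fromList (_ ∷ u) = cong suc (length-fromList u)

    ∈-fromList⁺ : ∀ {x} {xs : List A} (u : Unique xs) → x ∈ xs → x ∈# fromList u
    ∈-fromList⁺ (_ ∷ _) (here x≡y)  = Any#.here x≡y
    ∈-fromList⁺ (_ ∷ u) (there x∈) = Any#.there (∈-fromList⁺ u x∈)

    ∈-fromList⁻ : ∀ {x} {xs : List A} (u : Unique xs) → x ∈# fromList u → x ∈ xs
    ∈-fromList⁻ (_ ∷ _) (Any#.here x≡y)  = here x≡y
    ∈-fromList⁻ (_ ∷ u) (Any#.there x∈) = there (∈-fromList⁻ u x∈)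

  Unique-⊆⇒length≤ : ∀ {xs ys : List A} → Unique xs → Unique ys →
                     (∀ {x} → x ∈ xs → x ∈ ys) → length xs ≤ length ys
  Unique-⊆⇒length≤ uxs uys xs⊆ys = subst₂ _≤_ (length-fromList uxs) (length-fromList uys)
    (Membership#ₚ.injection (setoid A) (λ x≢y → x≢y)
      (λ x∈ → ∈-fromList⁺ uys (xs⊆ys (∈-fromList⁻ uxs x∈))))

module _ {A B : Set} (f : A → B) where

  Unique-map⁺-∈ : ∀ {xs} → (∀ {x y} → x ∈ xs → y ∈ xs → x ≢ y → f x ≢ f y) →
                  Unique xs → Unique (map f xs)
  Unique-map⁺-∈ {[]}     _   []        = []
  Unique-map⁺-∈ {x ∷ xs} inj (x∉ ∷ u) =
    All.map⁺ (All.tabulate λ y∈ → inj (here refl) (there y∈) (All.lookup x∉ y∈))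
    ∷ Unique-map⁺-∈ (λ x∈ y∈ → inj (there x∈) (there y∈)) u

length-cartesianProduct : ∀ {A B : Set} (xs : List A) (ys : List B) →
  length (cartesianProduct xs ys) ≡ length xs * length ys
length-cartesianProduct []       ys = refl
length-cartesianProduct (x ∷ xs) ys = begin
  length (map (x ,_) ys ++ cartesianProduct xs ys)
    ≡⟨ length-++ (map (x ,_) ys) ⟩
  length (map (x ,_) ys) + length (cartesianProduct xs ys)
    ≡⟨ cong₂ _+_ (length-map (x ,_) ys) (length-cartesianProduct xs ys) ⟩
  length ys + length xs * length ys
    ∎
  where open ≡-Reasoning

n<[2+k]^n : ∀ k n → n < (2 + k) ^ n
n<[2+k]^n k zero    = z<s
n<[2+k]^n k (suc n) = begin-strict
  suc n                   ≤⟨ n<[2+k]^n k n ⟩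
  (2 + k) ^ n             <⟨ m<m*n ((2 + k) ^ n) (2 + k) {{m^n≢0 (2 + k) n}} (s≤s (s≤s z≤n)) ⟩
  (2 + k) ^ n * (2 + k)   ≡⟨ *-comm ((2 + k) ^ n) (2 + k) ⟩
  (2 + k) ^ suc n         ∎
  where open ≤-Reasoning

valFuel-≥ : ∀ k e f n → n ≢ 0 → (2 + k) ^ e ∣ n → e ≤ f → e ≤ valFuel k f n
valFuel-≥ k zero    f       n       _   _      _         = z≤n
valFuel-≥ k (suc e) (suc f) zero    n≢0 _      _         = contradiction refl n≢0
valFuel-≥ k (suc e) (suc f) (suc n) n≢0 pᵉ∣n   (s≤s e≤f) with (2 + k) ∣? suc n
... | yes p∣n = s≤s (valFuel-≥ k e f (suc n / (2 + k)) n/p≢0 (m*n∣o⇒n∣o/m (2 + k) _ pᵉ∣n) e≤f)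
  where
  n/p≢0 : suc n / (2 + k) ≢ 0
  n/p≢0 eq = n≢0 (trans (sym (m/n*n≡m p∣n)) (cong (_* (2 + k)) eq))
... | no p∤n = contradiction (∣-trans (m∣m*n ((2 + k) ^ e)) pᵉ∣n) p∤n

pow∣⇒≤val : ∀ k e n → n ≢ 0 → (2 + k) ^ e ∣ n → e ≤ val k n
pow∣⇒≤val k e n n≢0 pᵉ∣n = valFuel-≥ k e n n n≢0 pᵉ∣n
  (<⇒≤ (<-≤-trans (n<[2+k]^n k e) (∣⇒≤ {{≢-nonZero n≢0}} pᵉ∣n)))

^-mono-∣ : ∀ p {e f} → e ≤ f → p ^ e ∣ p ^ f
^-mono-∣ p {e} {f} e≤f = divides (p ^ (f ∸ e)) (begin
  p ^ f                 ≡⟨ cong (p ^_) (sym (m+[n∸m]≡n e≤f)) ⟩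
  p ^ (e + (f ∸ e))     ≡⟨ ^-distribˡ-+-* p e (f ∸ e) ⟩
  p ^ e * p ^ (f ∸ e)   ≡⟨ *-comm (p ^ e) _ ⟩
  p ^ (f ∸ e) * p ^ e   ∎)
  where open ≡-Reasoning

module _ (p : ℕ) .{{_ : NonTrivial p}} where

  factorOut : ∀ r → Acc _<_ r → r ≢ 0 → ∃₂ λ e s → r ≡ p ^ e * s × ¬ p ∣ s
  factorOut r (acc rec) r≢0 with p ∣? r
  ... | no p∤r = 0 , r , sym (+-identityʳ r) , p∤r
  ... | yes (divides s refl) with factorOut s (rec s<s*p) s≢0
    where
    s≢0 : s ≢ 0
    s≢0 refl = r≢0 refl
    s<s*p : s < s * p
    s<s*p = m<m*n s p {{≢-nonZero s≢0}} (nonTrivial⇒n>1 p)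
  ... | e , t , refl , p∤t = suc e , t , pull , p∤t
    where
    pull : p ^ e * t * p ≡ p * p ^ e * t
    pull = trans (*-comm _ p) (sym (*-assoc p _ t))

n≤⌈n/2⌉+⌈n/2⌉ : ∀ n → n ≤ ⌈ n /2⌉ + ⌈ n /2⌉
n≤⌈n/2⌉+⌈n/2⌉ n = begin
  n                     ≡⟨ sym (⌊n/2⌋+⌈n/2⌉≡n n) ⟩
  ⌊ n /2⌋ + ⌈ n /2⌉     ≤⟨ +-monoˡ-≤ ⌈ n /2⌉ (⌊n/2⌋≤⌈n/2⌉ n) ⟩
  ⌈ n /2⌉ + ⌈ n /2⌉     ∎
  where open ≤-Reasoning

∣⇒≢0 : ∀ {r n} → r ∣ n → n ≢ 0 → r ≢ 0
∣⇒≢0 r∣n n≢0 refl = n≢0 (0∣⇒≡0 r∣n)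

starUpTo²-cofactor : ∀ k n → n ≢ 0 →
  ∃ λ r → r ∣ n × n ∣ starUpTo k n * starUpTo k n * r × (2 + k) Rough r
starUpTo²-cofactor zero n _ = n , ∣-refl , ∣-reflexive (sym (*-identityˡ n)) , 2-rough
starUpTo²-cofactor (suc k) n n≢0 with starUpTo²-cofactor k n n≢0 | prime? (2 + k)
... | r , r∣n , n∣S²r , rough | no ¬prime =
  r , r∣n , n∣S²r , ∤⇒rough-suc (λ p∣r → ¬prime (rough∧∣⇒prime rough p∣r)) rough
... | r , r∣n , n∣S²r , rough | yes _
  with factorOut (2 + k) r (<-wellFounded r) (∣⇒≢0 r∣n n≢0)
... | e , s , refl , p∤s =
  s , ∣-trans s∣pᵉs r∣n , ∣-trans n∣S²r S²pᵉs∣[XS]²s ,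
  ∤⇒rough-suc p∤s (rough∧∣⇒rough rough s∣pᵉs)
  where
  p c X S : ℕ
  p = 2 + k
  c = ⌈ val k n /2⌉
  X = p ^ c
  S = starUpTo k n
  s∣pᵉs : s ∣ p ^ e * s
  s∣pᵉs = n∣m*n (p ^ e)
  pᵉ∣X² : p ^ e ∣ X * X
  pᵉ∣X² = subst (p ^ e ∣_) (^-distribˡ-+-* p c c)
    (^-mono-∣ p (≤-trans (pow∣⇒≤val k e n n≢0 (∣-trans (m∣m*n s) r∣n)) (n≤⌈n/2⌉+⌈n/2⌉ (val k n))))
  S²pᵉs∣[XS]²s : S * S * (p ^ e * s) ∣ X * S * (X * S) * s
  S²pᵉs∣[XS]²s = subst₂ _∣_ (x∙yz≈y∙xz (p ^ e) (S * S) s)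
    (trans (sym (*-assoc (X * X) (S * S) s)) (cong (_* s) (interchange X X S S)))
    (*-monoˡ-∣ (S * S * s) pᵉ∣X²)

n∣star[n]*star[n] : ∀ n → n ≢ 0 → n ∣ star n * star n
n∣star[n]*star[n] n n≢0 with starUpTo²-cofactor n n n≢0
... | zero , r∣n , _ , _ = contradiction (0∣⇒≡0 r∣n) n≢0
... | suc zero , _ , n∣S² , _ = subst (n ∣_) (*-identityʳ _) n∣S²
... | suc (suc _) , r∣n , _ , rough =
  contradiction (≤-trans (rough⇒≤ rough) (∣⇒≤ {{≢-nonZero n≢0}} r∣n))
    (λ 2+n≤n → 1+n≰n (≤-trans (n≤1+n _) 2+n≤n))

cofactor∣star : ∀ n .{{_ : NonZero n}} q → n ≡ star n * q → q ∣ star n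
cofactor∣star n q n≡S*q = *-cancelˡ-∣ (star n) {{S-nonZero}}
  (subst (_∣ star n * star n) n≡S*q (n∣star[n]*star[n] n (≢-nonZero⁻¹ n)))
  where
  S-nonZero : NonZero (star n)
  S-nonZero = ≢-nonZero λ S≡0 → ≢-nonZero⁻¹ n (trans n≡S*q (cong (_* q) S≡0))

module _ (q : ℕ) .{{_ : NonZero q}} where

  private instance
    gcd-nonZero : ∀ {x} → NonZero (gcd q x)
    gcd-nonZero {x} = ≢-nonZero (gcd[m,n]≢0 q x (inj₁ (≢-nonZero⁻¹ q)))

  order : ℕ → ℕ
  order x = q / gcd q x

  order*gcd≡q : ∀ x → order x * gcd q x ≡ q
  order*gcd≡q x = m/n*n≡m (gcd[m,n]∣m q x)

  cofactor*gcd≡x : ∀ x → x / gcd q x * gcd q x ≡ x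
  cofactor*gcd≡x x = m/n*n≡m (gcd[m,n]∣n q x)

  order≢0 : ∀ x → order x ≢ 0
  order≢0 x eq = ≢-nonZero⁻¹ q (trans (sym (order*gcd≡q x)) (cong (_* gcd q x) eq))

  ∣*⇒order∣ : ∀ x i → q ∣ x * i → order x ∣ i
  ∣*⇒order∣ x i q∣xi = coprime-divisor (coprime-/gcd q x) (*-cancelʳ-∣ (gcd q x) g∣)
    where
    g∣ : order x * gcd q x ∣ x / gcd q x * i * gcd q x
    g∣ = subst₂ _∣_ (sym (order*gcd≡q x))
      (trans (cong (_* i) (sym (cofactor*gcd≡x x))) (xy∙z≈xz∙y (x / gcd q x) (gcd q x) i)) q∣xi

  ∤⇒1<order : ∀ x → ¬ q ∣ x → 1 < order x
  ∤⇒1<order x q∤x with order x in eq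
  ... | zero = contradiction eq (order≢0 x)
  ... | suc zero =
    contradiction (divides (x / gcd q x) (trans (sym (cofactor*gcd≡x x)) (cong (x / gcd q x *_) g≡q))) q∤x
    where
    g≡q : gcd q x ≡ q
    g≡q = trans (sym (*-identityˡ _)) (trans (cong (_* gcd q x) (sym eq)) (order*gcd≡q x))
  ... | suc (suc _) = s≤s (s≤s z≤n)

  order-injective : ∀ x y → ¬ q ∣ x → q * q ∣ x * y → order x ≢ order y
  order-injective x y q∤x q²∣xy dₓ≡dᵧ = <⇒≢ (∤⇒1<order x q∤x) (sym d≡1)
    where
    d g a b : ℕ
    d = order x
    g = gcd q x
    a = x / g
    b = y / gcd q y
    g≡gᵧ : g ≡ gcd q y
    g≡gᵧ = *-cancelˡ-≡ g (gcd q y) d {{≢-nonZero (order≢0 x)}}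
      (trans (order*gcd≡q x) (trans (sym (order*gcd≡q y)) (cong (_* gcd q y) (sym dₓ≡dᵧ))))
    y≡b*g : y ≡ b * g
    y≡b*g = trans (sym (cofactor*gcd≡x y)) (cong (b *_) (sym g≡gᵧ))
    d*d∣a*b : d * d * (g * g) ∣ a * b * (g * g)
    d*d∣a*b = subst₂ _∣_
      (trans (cong₂ _*_ (sym (order*gcd≡q x)) (sym (order*gcd≡q x))) (interchange d g d g))
      (trans (cong₂ _*_ (sym (cofactor*gcd≡x x)) y≡b*g) (interchange a g b g))
      q²∣xy
    d∣b : d ∣ b
    d∣b = coprime-divisor (coprime-/gcd q x)
      (∣-trans (m∣m*n d) (*-cancelʳ-∣ (g * g) {{m*n≢0 g g}} d*d∣a*b))
    d≡1 : d ≡ 1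
    d≡1 = subst (λ d′ → Coprime d′ b) (sym dₓ≡dᵧ) (coprime-/gcd q y) (∣-refl , d∣b)

  module _ {A : Set} (h : A → ℕ) where

    -- The orders of the elements of X are distinct divisors of i exceeding 1.
    annihilated-length< : ∀ (X : List A) → Unique X → All (λ x → ¬ q ∣ h x) X →
      (∀ {x y} → x ∈ X → y ∈ X → x ≢ y → q * q ∣ h x * h y) →
      ∀ i .{{_ : NonZero i}} → All (λ x → q ∣ h x * i) X → length X < i
    annihilated-length< X uX q∤X q²∣X i q∣X*i = ≤-pred (begin
      suc (suc (length X))          ≡⟨ cong (2 +_) (sym (length-map (order ∘ h) X)) ⟩
      length orders                 ≤⟨ Unique-⊆⇒length≤ uOrders (Unique.upTo⁺ (suc i)) orders⊆ ⟩
      length (upTo (suc i))         ≡⟨ length-upTo (suc i) ⟩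
      suc i                         ∎)
      where
      open ≤-Reasoning
      orders : List ℕ
      orders = 0 ∷ 1 ∷ map (order ∘ h) X
      1<orders : ∀ {d} → d ∈ map (order ∘ h) X → 1 < d
      1<orders d∈ with ∈-map⁻ (order ∘ h) d∈
      ... | x , x∈ , refl = ∤⇒1<order (h x) (All.lookup q∤X x∈)
      uOrders : Unique orders
      uOrders = All.tabulate (λ { (here refl) () ; (there d∈) 0≡d → <⇒≢ (<-trans z<s (1<orders d∈)) 0≡d })
              ∷ All.tabulate (λ d∈ → <⇒≢ (1<orders d∈))
              ∷ Unique-map⁺-∈ (order ∘ h)
                  (λ x∈ y∈ x≢y → order-injective (h _) (h _) (All.lookup q∤X x∈) (q²∣X x∈ y∈ x≢y)) uX
      orders⊆ : ∀ {d} → d ∈ orders → d ∈ upTo (suc i)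
      orders⊆ (here refl)         = ∈-upTo⁺ z<s
      orders⊆ (there (here refl)) = ∈-upTo⁺ (s≤s (>-nonZero⁻¹ i))
      orders⊆ (there (there d∈)) with ∈-map⁻ (order ∘ h) d∈
      ... | x , x∈ , refl = ∈-upTo⁺ (s≤s (∣⇒≤ (∣*⇒order∣ (h x) i (All.lookup q∣X*i x∈))))

n∸1<n : ∀ n .{{_ : NonZero n}} → n ∸ 1 < n
n∸1<n n = ∸-monoʳ-< z<s (>-nonZero⁻¹ n)

module Multiples (n S q : ℕ) .{{_ : NonZero n}} (n≡S*q : n ≡ S * q) (q∣S : q ∣ S) where

  instance
    S-nonZero : NonZero S
    S-nonZero = ≢-nonZero λ { refl → ≢-nonZero⁻¹ n n≡S*q }
    q-nonZero : NonZero q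
    q-nonZero = ≢-nonZero λ { refl → ≢-nonZero⁻¹ n (trans n≡S*q (*-zeroʳ S)) }

  S∣⇒q∣⇒n∣* : ∀ {u v} → S ∣ u → q ∣ v → n ∣ u * v
  S∣⇒q∣⇒n∣* S∣u q∣v = subst (_∣ _) (sym n≡S*q) (*-pres-∣ S∣u q∣v)

  q∣⇒S∣⇒n∣* : ∀ {u v} → q ∣ u → S ∣ v → n ∣ u * v
  q∣⇒S∣⇒n∣* {u} {v} q∣u S∣v = subst (n ∣_) (*-comm v u) (S∣⇒q∣⇒n∣* S∣v q∣u)

  S∣⇒S∣⇒n∣* : ∀ {u v} → S ∣ u → S ∣ v → n ∣ u * v
  S∣⇒S∣⇒n∣* S∣u = q∣⇒S∣⇒n∣* (∣-trans q∣S S∣u)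

  q∸1<q : q ∸ 1 < q
  q∸1<q = n∸1<n q

  q*q∣n : q * q ∣ n
  q*q∣n = subst (q * q ∣_) (sym n≡S*q) (*-monoˡ-∣ q q∣S)

  multiple : ℕ → Fin n
  multiple i = (suc i * S) mod n

  toℕ-multiple : ∀ {i} → suc i < q → toℕ (multiple i) ≡ suc i * S
  toℕ-multiple {i} i<q = trans (toℕ-fromℕ< _) (m<n⇒m%n≡m (begin-strict
    suc i * S   <⟨ *-monoˡ-< S i<q ⟩
    q * S       ≡⟨ trans (*-comm q S) (sym n≡S*q) ⟩
    n           ∎))
    where open ≤-Reasoning

  multiples : ℕ → List (Fin n)
  multiples k = map multiple (upTo k)

  module _ {k} (k<q : k < q) where

    private
      suc<q : ∀ {i} → i ∈ upTo k → suc i < q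
      suc<q i∈ = <-≤-trans (s≤s (∈-upTo⁻ i∈)) k<q

    ∈-multiples⁻ : ∀ {y} → y ∈ multiples k → ∃ λ i → i < k × toℕ y ≡ suc i * S
    ∈-multiples⁻ y∈ with ∈-map⁻ multiple y∈
    ... | i , i∈ , refl = i , ∈-upTo⁻ i∈ , toℕ-multiple (suc<q i∈)

    S∣multiples : ∀ {y} → y ∈ multiples k → S ∣ toℕ y
    S∣multiples y∈ with ∈-multiples⁻ y∈
    ... | i , _ , y≡ = divides (suc i) y≡

    multiples≢0 : ∀ {y} → y ∈ multiples k → toℕ y ≢ 0
    multiples≢0 y∈ y≡0 with ∈-multiples⁻ y∈
    ... | i , _ , y≡ = ≢-nonZero⁻¹ (suc i * S) {{m*n≢0 (suc i) S}} (trans (sym y≡) y≡0)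

    multiples-unique : Unique (multiples k)
    multiples-unique = Unique-map⁺-∈ multiple
      (λ i∈ j∈ i≢j eq → i≢j (suc-injective (*-cancelʳ-≡ _ _ S
        (trans (sym (toℕ-multiple (suc<q i∈))) (trans (cong toℕ eq) (toℕ-multiple (suc<q j∈)))))))
      (Unique.upTo⁺ k)

    length-multiples : length (multiples k) ≡ k
    length-multiples = trans (length-map multiple (upTo k)) (length-upTo k)

  module Normalise {A : List (Fin n)} (cliqueA : IsClique (ℤ/ n) A) where

    private
      uA : Unique A
      uA = proj₁ cliqueA
      clA : ∀ {x y} → x ∈ A → y ∈ A → x ≢ y → n ∣ toℕ x * toℕ y
      clA = proj₂ (proj₂ cliqueA)
      q∣? : (x : Fin n) → Dec (q ∣ toℕ x)
      q∣? x = q ∣? toℕ x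
      q∤? : (x : Fin n) → Dec (¬ q ∣ toℕ x)
      q∤? x = ¬? (q∣? x)

    divisible nondivisible : List (Fin n)
    divisible    = filter q∣? A
    nondivisible = filter q∤? A

    private
      k : ℕ
      k = length nondivisible
      nondivisible⊆A : ∀ {x} → x ∈ nondivisible → x ∈ A
      nondivisible⊆A = proj₁ ∘ ∈-filter⁻ q∤? {xs = A}
      q∤nondivisible : ∀ {x} → x ∈ nondivisible → ¬ q ∣ toℕ x
      q∤nondivisible = proj₂ ∘ ∈-filter⁻ q∤? {xs = A}
      divisible⊆A : ∀ {x} → x ∈ divisible → x ∈ A
      divisible⊆A = proj₁ ∘ ∈-filter⁻ q∣? {xs = A}
      q∣divisible : ∀ {x} → x ∈ divisible → q ∣ toℕ x
      q∣divisible = proj₂ ∘ ∈-filter⁻ q∣? {xs = A}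

    length-nondivisible< : ∀ i .{{_ : NonZero i}} → All (λ x → q ∣ toℕ x * i) nondivisible → k < i
    length-nondivisible< = annihilated-length< q toℕ nondivisible
      (Unique.filter⁺ q∤? uA) (All.tabulate q∤nondivisible)
      (λ x∈ y∈ x≢y → ∣-trans q*q∣n (clA (nondivisible⊆A x∈) (nondivisible⊆A y∈) x≢y))

    k<q : k < q
    k<q = length-nondivisible< q (All.tabulate λ {x} _ → n∣m*n (toℕ x))

    -- A multiple (i + 1)S in A would annihilate every non-multiple of q, forcing k < i + 1.
    multiples∉A : ∀ {y} → y ∈ multiples k → y ∉ A
    multiples∉A y∈ y∈A with ∈-multiples⁻ k<q y∈
    ... | i , i<k , y≡ = <⇒≱ (length-nondivisible< (suc i) (All.tabulate q∣x[i+1])) i<k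
      where
      q∣x[i+1] : ∀ {x} → x ∈ nondivisible → q ∣ toℕ x * suc i
      q∣x[i+1] {x} x∈ = *-cancelʳ-∣ S (subst₂ _∣_ (trans n≡S*q (*-comm S q))
        (trans (cong (toℕ x *_) y≡) (sym (*-assoc (toℕ x) (suc i) S)))
        (clA (nondivisible⊆A x∈) y∈A λ { refl → q∤nondivisible x∈ (∣-trans q∣S (S∣multiples k<q y∈)) }))

    normalised : List (Fin n)
    normalised = divisible ++ multiples k

    private
      q∣normalised′ : ∀ {x} → x ∈ divisible ⊎ x ∈ multiples k → q ∣ toℕ x
      q∣normalised′ (inj₁ x∈) = q∣divisible x∈
      q∣normalised′ (inj₂ x∈) = ∣-trans q∣S (S∣multiples k<q x∈)

      zeroDivisor′ : ∀ {x} → x ∈ divisible ⊎ x ∈ multiples k → ZeroDivisor (ℤ/ n) x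
      zeroDivisor′ (inj₁ x∈) = All.lookup (proj₁ (proj₂ cliqueA)) (divisible⊆A x∈)
      zeroDivisor′ {x} (inj₂ x∈) =
        multiples≢0 k<q x∈ , x , multiples≢0 k<q x∈ ,
        S∣⇒S∣⇒n∣* (S∣multiples k<q x∈) (S∣multiples k<q x∈)

      annihilate′ : ∀ {x y} → x ∈ divisible ⊎ x ∈ multiples k → y ∈ divisible ⊎ y ∈ multiples k →
                    x ≢ y → n ∣ toℕ x * toℕ y
      annihilate′ (inj₁ x∈) (inj₁ y∈) x≢y = clA (divisible⊆A x∈) (divisible⊆A y∈) x≢y
      annihilate′ (inj₁ x∈) (inj₂ y∈) _   = q∣⇒S∣⇒n∣* (q∣divisible x∈) (S∣multiples k<q y∈)
      annihilate′ (inj₂ x∈) (inj₁ y∈) _   = S∣⇒q∣⇒n∣* (S∣multiples k<q x∈) (q∣divisible y∈)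
      annihilate′ (inj₂ x∈) (inj₂ y∈) _   = S∣⇒S∣⇒n∣* (S∣multiples k<q x∈) (S∣multiples k<q y∈)

    normalised-clique : IsClique (ℤ/ n) normalised
    normalised-clique =
      Unique.++⁺ (Unique.filter⁺ q∣? uA) (multiples-unique k<q)
        (λ (x∈F , x∈M) → multiples∉A x∈M (divisible⊆A x∈F)) ,
      All.tabulate (zeroDivisor′ ∘ ∈-++⁻ divisible) ,
      λ x∈ y∈ → annihilate′ (∈-++⁻ divisible x∈) (∈-++⁻ divisible y∈)

    q∣normalised : All (λ x → q ∣ toℕ x) normalised
    q∣normalised = All.tabulate (q∣normalised′ ∘ ∈-++⁻ divisible)

    length-normalised : length normalised ≡ length A
    length-normalised = begin
      length (divisible ++ multiples k)         ≡⟨ length-++ divisible ⟩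
      length divisible + length (multiples k)   ≡⟨ cong (length divisible +_) (length-multiples k<q) ⟩
      length divisible + k                      ≡⟨ length-filter+length-filter-¬ q∣? A ⟩
      length A                                  ∎
      where open ≡-Reasoning

∣*0 : ∀ n u → n ∣ u * 0
∣*0 n u = subst (n ∣_) (sym (*-zeroʳ u)) (n ∣0)

module Product (n′ m′ S q T r : ℕ) (n≡S*q : 2 + n′ ≡ S * q) (m≡T*r : 2 + m′ ≡ T * r)
               (q∣S : q ∣ S) (r∣T : r ∣ T)
               {A : List (Fin (2 + n′))} (cliqueA : IsClique (ℤ/ (2 + n′)) A) (q∣A : All (λ x → q ∣ toℕ x) A)
               {B : List (Fin (2 + m′))} (cliqueB : IsClique (ℤ/ (2 + m′)) B) (r∣B : All (λ y → r ∣ toℕ y) B)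
               where

  private
    n m : ℕ
    n = 2 + n′
    m = 2 + m′
    module Mₙ = Multiples n S q n≡S*q q∣S
    module Mₘ = Multiples m T r m≡T*r r∣T
    Sᵐ : List (Fin n)
    Sᵐ = Mₙ.multiples (q ∸ 1)
    Tᵐ : List (Fin m)
    Tᵐ = Mₘ.multiples (r ∸ 1)

  productClique : List (Fin n × Fin m)
  productClique = map (_, zero) A ++ map (zero ,_) B ++ cartesianProduct Sᵐ Tᵐ

  private
    data Kind : Fin n × Fin m → Set where
      left   : ∀ {x} → x ∈ A → Kind (x , zero)
      right  : ∀ {y} → y ∈ B → Kind (zero , y)
      middle : ∀ {x y} → x ∈ Sᵐ → y ∈ Tᵐ → Kind (x , y)

    kind : ∀ {p} → p ∈ productClique → Kind p
    kind p∈ with ∈-++⁻ (map (_, zero) A) p∈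
    ... | inj₁ p∈A with ∈-map⁻ (_, zero) p∈A
    ...   | x , x∈ , refl = left x∈
    kind p∈ | inj₂ p∈′ with ∈-++⁻ (map (zero ,_) B) p∈′
    ... | inj₁ p∈B with ∈-map⁻ (zero ,_) p∈B
    ...   | y , y∈ , refl = right y∈
    kind p∈ | inj₂ p∈′ | inj₂ p∈ST with ∈-cartesianProduct⁻ Sᵐ Tᵐ p∈ST
    ... | x∈ , y∈ = middle x∈ y∈

    cliqueA-annihilates : ∀ {x x′} → x ∈ A → x′ ∈ A → x ≢ x′ → n ∣ toℕ x * toℕ x′
    cliqueA-annihilates = proj₂ (proj₂ cliqueA)
    cliqueB-annihilates : ∀ {y y′} → y ∈ B → y′ ∈ B → y ≢ y′ → m ∣ toℕ y * toℕ y′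
    cliqueB-annihilates = proj₂ (proj₂ cliqueB)
    A≢0 : ∀ {x} → x ∈ A → toℕ x ≢ 0
    A≢0 x∈ = proj₁ (All.lookup (proj₁ (proj₂ cliqueA)) x∈)
    B≢0 : ∀ {y} → y ∈ B → toℕ y ≢ 0
    B≢0 y∈ = proj₁ (All.lookup (proj₁ (proj₂ cliqueB)) y∈)
    S∣ : ∀ {x} → x ∈ Sᵐ → S ∣ toℕ x
    S∣ = Mₙ.S∣multiples Mₙ.q∸1<q
    T∣ : ∀ {y} → y ∈ Tᵐ → T ∣ toℕ y
    T∣ = Mₘ.S∣multiples Mₘ.q∸1<q
    Sᵐ≢0 : ∀ {x} → x ∈ Sᵐ → toℕ x ≢ 0
    Sᵐ≢0 = Mₙ.multiples≢0 Mₙ.q∸1<q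
    Tᵐ≢0 : ∀ {y} → y ∈ Tᵐ → toℕ y ≢ 0
    Tᵐ≢0 = Mₘ.multiples≢0 Mₘ.q∸1<q

    zeroDivisor : ∀ {p} → Kind p → ZeroDivisor (ℤ/× n m) p
    zeroDivisor (left {x} x∈)  =
      A≢0 x∈ ∘ proj₁ , (zero , suc zero) , (λ { (_ , ()) }) , ∣*0 n (toℕ x) , m ∣0
    zeroDivisor (right {y} y∈) =
      B≢0 y∈ ∘ proj₂ , (suc zero , zero) , (λ { (() , _) }) , n ∣0 , ∣*0 m (toℕ y)
    zeroDivisor (middle {x} {y} x∈ y∈) =
      Sᵐ≢0 x∈ ∘ proj₁ , (x , y) , Sᵐ≢0 x∈ ∘ proj₁ ,
      Mₙ.S∣⇒S∣⇒n∣* (S∣ x∈) (S∣ x∈) , Mₘ.S∣⇒S∣⇒n∣* (T∣ y∈) (T∣ y∈)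

    annihilate : ∀ {p p′} → Kind p → Kind p′ → p ≢ p′ → ZeroMul.MulZero (ℤ/× n m) p p′
    annihilate (left x∈)       (left x′∈)       p≢p′ = cliqueA-annihilates x∈ x′∈ (p≢p′ ∘ cong (_, zero)) , m ∣0
    annihilate (left {x} _)    (right _)        _    = ∣*0 n (toℕ x) , m ∣0
    annihilate (left x∈)       (middle x′∈ _)   _    = Mₙ.q∣⇒S∣⇒n∣* (All.lookup q∣A x∈) (S∣ x′∈) , m ∣0
    annihilate (right {y} _)   (left _)         _    = n ∣0 , ∣*0 m (toℕ y)
    annihilate (right y∈)      (right y′∈)      p≢p′ = n ∣0 , cliqueB-annihilates y∈ y′∈ (p≢p′ ∘ cong (zero ,_))
    annihilate (right y∈)      (middle _ y′∈)   _    = n ∣0 , Mₘ.q∣⇒S∣⇒n∣* (All.lookup r∣B y∈) (T∣ y′∈)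
    annihilate (middle {y = y} x∈ _) (left x′∈)  _    =
      Mₙ.S∣⇒q∣⇒n∣* (S∣ x∈) (All.lookup q∣A x′∈) , ∣*0 m (toℕ y)
    annihilate (middle {x} _ y∈) (right y′∈)     _    =
      ∣*0 n (toℕ x) , Mₘ.S∣⇒q∣⇒n∣* (T∣ y∈) (All.lookup r∣B y′∈)
    annihilate (middle x∈ y∈)  (middle x′∈ y′∈) _    =
      Mₙ.S∣⇒S∣⇒n∣* (S∣ x∈) (S∣ x′∈) , Mₘ.S∣⇒S∣⇒n∣* (T∣ y∈) (T∣ y′∈)

    multiples-unique : Unique (cartesianProduct Sᵐ Tᵐ)
    multiples-unique = Unique.cartesianProduct⁺
      (Mₙ.multiples-unique Mₙ.q∸1<q) (Mₘ.multiples-unique Mₘ.q∸1<q)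

    right∉middle : ∀ {p} → p ∈ map (zero ,_) B → p ∉ cartesianProduct Sᵐ Tᵐ
    right∉middle p∈ p∈ST with ∈-map⁻ (zero ,_) p∈
    ... | _ , _ , refl = Sᵐ≢0 (proj₁ (∈-cartesianProduct⁻ Sᵐ Tᵐ p∈ST)) refl

    left∉rest : ∀ {p} → p ∈ map (_, zero) A → p ∉ map (zero ,_) B ++ cartesianProduct Sᵐ Tᵐ
    left∉rest p∈ p∈rest with ∈-map⁻ (_, zero) p∈ | ∈-++⁻ (map (zero ,_) B) p∈rest
    ... | x , x∈ , refl | inj₁ p∈B with ∈-map⁻ (zero ,_) p∈B
    ...   | _ , _ , x,0≡0,y = A≢0 x∈ (cong (toℕ ∘ proj₁) x,0≡0,y)
    left∉rest p∈ p∈rest | _ , _ , refl | inj₂ p∈ST = Tᵐ≢0 (proj₂ (∈-cartesianProduct⁻ Sᵐ Tᵐ p∈ST)) refl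

  productClique-isClique : IsClique (ℤ/× n m) productClique
  productClique-isClique =
    Unique.++⁺ (Unique.map⁺ (cong proj₁) (proj₁ cliqueA))
      (Unique.++⁺ (Unique.map⁺ (cong proj₂) (proj₁ cliqueB)) multiples-unique
        (λ (p∈B , p∈ST) → right∉middle p∈B p∈ST))
      (λ (p∈A , p∈rest) → left∉rest p∈A p∈rest) ,
    All.tabulate (zeroDivisor ∘ kind) ,
    λ p∈ p′∈ → annihilate (kind p∈) (kind p′∈)

  length-productClique : length productClique ≡ length A + length B + (q ∸ 1) * (r ∸ 1)
  length-productClique = begin
    length productClique
      ≡⟨ length-++ (map (_, zero) A) ⟩
    length (map (_, zero) A) + length (map (zero ,_) B ++ cartesianProduct Sᵐ Tᵐ)
      ≡⟨ cong₂ _+_ (length-map (_, zero) A) (length-++ (map (zero ,_) B)) ⟩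
    length A + (length (map (zero ,_) B) + length (cartesianProduct Sᵐ Tᵐ))
      ≡⟨ cong (λ l → length A + (l + length (cartesianProduct Sᵐ Tᵐ))) (length-map (zero ,_) B) ⟩
    length A + (length B + length (cartesianProduct Sᵐ Tᵐ))
      ≡⟨ cong (λ l → length A + (length B + l)) (length-cartesianProduct Sᵐ Tᵐ) ⟩
    length A + (length B + length Sᵐ * length Tᵐ)
      ≡⟨ cong₂ (λ s t → length A + (length B + s * t))
           (Mₙ.length-multiples Mₙ.q∸1<q) (Mₘ.length-multiples Mₘ.q∸1<q) ⟩
    length A + (length B + (q ∸ 1) * (r ∸ 1))
      ≡⟨ sym (+-assoc (length A) (length B) _) ⟩
    length A + length B + (q ∸ 1) * (r ∸ 1)
      ∎
    where open ≡-Reasoning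

theorem3p8 : (n m : ℕ) → 2 ≤ n → 2 ≤ m →
    (a b c : ℕ) →
    IsCliqueNumber (ℤ/ n) a → IsCliqueNumber (ℤ/ m) b →
    IsCliqueNumber (ℤ/× n m) c →
    (q r : ℕ) → n ≡ star n * q → m ≡ star m * r →
    a + b + (q ∸ 1) * (r ∸ 1) ≤ c
theorem3p8 (suc (suc n′)) (suc (suc m′)) _ _ _ _ c
           ((A , cliqueA , refl) , _) ((B , cliqueB , refl) , _) (_ , maximal) q r n≡S*q m≡T*r =
  begin
    length A + length B + (q ∸ 1) * (r ∸ 1)
      ≡⟨ cong₂ (λ a b → a + b + (q ∸ 1) * (r ∸ 1)) (sym A′.length-normalised) (sym B′.length-normalised) ⟩
    length A′.normalised + length B′.normalised + (q ∸ 1) * (r ∸ 1)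
      ≡⟨ sym P.length-productClique ⟩
    length P.productClique
      ≤⟨ maximal P.productClique P.productClique-isClique ⟩
    c ∎
  where
  open ≤-Reasoning
  q∣S : q ∣ star (2 + n′)
  q∣S = cofactor∣star (2 + n′) q n≡S*q
  r∣T : r ∣ star (2 + m′)
  r∣T = cofactor∣star (2 + m′) r m≡T*r
  module A′ = Multiples.Normalise (2 + n′) (star (2 + n′)) q n≡S*q q∣S cliqueA
  module B′ = Multiples.Normalise (2 + m′) (star (2 + m′)) r m≡T*r r∣T cliqueB
  module P = Product n′ m′ (star (2 + n′)) q (star (2 + m′)) r n≡S*q m≡T*r q∣S r∣T
    A′.normalised-clique A′.q∣normalised B′.normalised-clique B′.q∣normalised
theorem3p8 (suc zero) _ (s≤s ()) _
theorem3p8 (suc (suc _)) (suc zero) _ (s≤s ())
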